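{- An algebra $\langle M,+,\vee,\wedge,0,1,-1\rangle$ (arities $2,2,2,0,0,0$) is isomorphic to a subreduct of a unital commutative $\ell$-group if and only if it is a cancellative unital commutative distributive $\ell$-monoid.
   Context: A commutative $\ell$-group is a commutative group $\langle G,+,0\rangle$ with a translation-invariant lattice order; a strong unit is an element $u\geq 0$ such that for every $g\in G$ there is $n\in\mathbb{N}$ with $g\leq nu$; a unital commutative $\ell$-group is one with a distinguished strong unit $u$. A subreduct of such a group is a subalgebra of its reduct $\langle G,+,\vee,\wedge,0,u,-u\rangle$ (so $1$ is interpreted as $u$ and $-1$ as $-u$). A unital commutative distributive $\ell$-monoid is an algebra $\langle M,+,\vee,\wedge,0,1,-1\rangle$ such that: $\langle M,\vee,\wedge\rangle$ is a distributive lattice; $\langle M,+,0\rangle$ is a commutative monoid; $+$ distributes over $\vee$ and $\wedge$; $-1+1=0$; $-1\leq 0\leq 1$; and for every $x\in M$ there is $n\in\mathbb{N}\setminus\{0\}$ with $(-1)+\dots+(-1)\leq x\leq 1+\dots+1$ ($n$ summands each). It is cancellative if $x+z=y+z$ implies $x=y$ for all $x,y,z\in M$. -}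

module Defs where

open import Level using (0ℓ)
open import Data.Nat using (ℕ; zero; suc)
open import Data.Product using (Σ; ∃; _×_; _,_)
open import Relation.Binary.Structures using (IsEquivalence)
open import Relation.Unary using (Pred; _∈_)
open import Algebra.Structures using (IsCommutativeMonoid; IsAbelianGroup)
open import Algebra.Lattice.Structures using (IsLattice; IsDistributiveLattice)

record RawAlg : Set₁ where
  infixl 6 _+_
  infixr 5 _∨_
  infixr 7 _∧_
  infix 4 _≈_
  field
    Carrier       : Set
    _≈_           : Carrier → Carrier → Set
    _+_ _∨_ _∧_   : Carrier → Carrier → Carrier
    0# 1# -1#     : Carrier
    isEquivalence : IsEquivalence _≈_
    +-cong        : ∀ {x y z w} → x ≈ y → z ≈ w → (x + z) ≈ (y + w)
    ∨-cong        : ∀ {x y z w} → x ≈ y → z ≈ w → (x ∨ z) ≈ (y ∨ w)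
    ∧-cong        : ∀ {x y z w} → x ≈ y → z ≈ w → (x ∧ z) ≈ (y ∧ w)

  _≤_ : Carrier → Carrier → Set
  x ≤ y = (x ∨ y) ≈ y

  times : ℕ → Carrier → Carrier
  times zero    x = 0#
  times (suc n) x = x + times n x

record IsUCDLMonoid (A : RawAlg) : Set where
  open RawAlg A
  field
    isDistributiveLattice : IsDistributiveLattice _≈_ _∨_ _∧_
    isCommutativeMonoid   : IsCommutativeMonoid _≈_ _+_ 0#
    +-distrib-∨           : ∀ x y z → (x + (y ∨ z)) ≈ ((x + y) ∨ (x + z))
    +-distrib-∧           : ∀ x y z → (x + (y ∧ z)) ≈ ((x + y) ∧ (x + z))
    -1+1≈0                : (-1# + 1#) ≈ 0#
    -1≤0                  : -1# ≤ 0#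
    0≤1                   : 0# ≤ 1#
    bounded               : ∀ x → ∃ λ n →
                              (times (suc n) -1# ≤ x) × (x ≤ times (suc n) 1#)

Cancellative : RawAlg → Set
Cancellative A = ∀ x y z → (x + z) ≈ (y + z) → x ≈ y
  where open RawAlg A

nsum : {C : Set} → (C → C → C) → C → ℕ → C → C
nsum _⊕_ e zero    x = e
nsum _⊕_ e (suc n) x = x ⊕ nsum _⊕_ e n x

record UnitalLGroup : Set₁ where
  infixl 6 _+_
  infixr 5 _∨_
  infixr 7 _∧_
  infix 4 _≈_
  field
    Carrier        : Set
    _≈_            : Carrier → Carrier → Set
    _+_ _∨_ _∧_    : Carrier → Carrier → Carrier
    -_             : Carrier → Carrier
    0#             : Carrier
    u              : Carrier
    isAbelianGroup : IsAbelianGroup _≈_ _+_ 0# -_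
    isLattice      : IsLattice _≈_ _∨_ _∧_
    translation-invariant : ∀ x y z → (x ∨ y) ≈ y → ((x + z) ∨ (y + z)) ≈ (y + z)
    u-nonneg              : (0# ∨ u) ≈ u
    u-strong              : ∀ g → ∃ λ n → (g ∨ nsum _+_ 0# n u) ≈ nsum _+_ 0# n u

  _≤_ : Carrier → Carrier → Set
  x ≤ y = (x ∨ y) ≈ y

  times : ℕ → Carrier → Carrier
  times = nsum _+_ 0#

-- Subreducts: subalgebras of ⟨G,+,∨,∧,0,u,-u⟩ (closed under ≈)

record IsSubreduct (G : UnitalLGroup) (S : Pred (UnitalLGroup.Carrier G) 0ℓ) : Set where
  open UnitalLGroup G
  field
    respects-≈ : ∀ {x y} → x ≈ y → x ∈ S → y ∈ S
    +-closed   : ∀ {x y} → x ∈ S → y ∈ S → (x + y) ∈ S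
    ∨-closed   : ∀ {x y} → x ∈ S → y ∈ S → (x ∨ y) ∈ S
    ∧-closed   : ∀ {x y} → x ∈ S → y ∈ S → (x ∧ y) ∈ S
    0-closed   : 0# ∈ S
    u-closed   : u ∈ S
    -u-closed  : (- u) ∈ S

record IsIsoToSubreduct (A : RawAlg) (G : UnitalLGroup)
         (S : Pred (UnitalLGroup.Carrier G) 0ℓ) : Set where
  module A = RawAlg A
  module G = UnitalLGroup G
  field
    f        : A.Carrier → G.Carrier
    f-into   : ∀ x → f x ∈ S
    f-cong   : ∀ {x y} → x A.≈ y → f x G.≈ f y
    f-inj    : ∀ {x y} → f x G.≈ f y → x A.≈ y
    f-onto   : ∀ {g} → g ∈ S → ∃ λ x → f x G.≈ g
    f-+      : ∀ x y → f (x A.+ y) G.≈ (f x G.+ f y)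
    f-∨      : ∀ x y → f (x A.∨ y) G.≈ (f x G.∨ f y)
    f-∧      : ∀ x y → f (x A.∧ y) G.≈ (f x G.∧ f y)
    f-0      : f A.0# G.≈ G.0#
    f-1      : f A.1# G.≈ G.u
    f--1     : f A.-1# G.≈ (G.- G.u)

IsoToSubreductOfUnitalLGroup : RawAlg → Set₁
IsoToSubreductOfUnitalLGroup A =
  Σ UnitalLGroup λ G → Σ (Pred (UnitalLGroup.Carrier G) 0ℓ) λ S →
    IsSubreduct G S × IsIsoToSubreduct A G S

-- (⇒) An algebra embedded in a unital ℓ-group inherits its equational laws and its
-- cancellation.  What needs an argument is that the lattice of an ℓ-group is
-- distributive, and that every g lies between n·(-u) and n·u, which follows from the
-- strong unit bounding both g and -g from above.
--
-- (⇐) Formal differences a ⊖ b of elements of the algebra, identified when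
-- a + d ≈ c + b, form an abelian group by cancellation; with
-- (a ⊖ b) ∨ (c ⊖ d) = (a + d) ∨ (c + b) ⊖ (b + d), and dually ∧, it is an ℓ-group
-- because + distributes over ∨ and ∧.  Then x ↦ x ⊖ 0 is the embedding, and 1 ⊖ 0 is
-- a strong unit: a ⊖ b lies below (n + m)·(1 ⊖ 0) when a ≤ n·1 and m·(-1) ≤ b.

module Submission where

open import Defs
open import Level using (0ℓ)
open import Data.Nat as ℕ using (zero; suc; z≤n; s≤s)
import Data.Nat.Properties as ℕ
open import Data.Product using (_×_; _,_; ∃)
open import Function.Bundles using (_⇔_; mk⇔)
open import Relation.Binary.Core using (Rel)
open import Relation.Binary.Structures using (IsEquivalence)
open import Relation.Binary.PropositionalEquality as ≡ using (_≡_)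
open import Relation.Unary using (Pred; _∈_)
open import Algebra.Core using (Op₁; Op₂)
open import Algebra.Bundles using (AbelianGroup; CommutativeMonoid; Monoid)
open import Algebra.Structures using (IsCommutativeMonoid; IsAbelianGroup)
open import Algebra.Morphism.Structures using (IsMonoidMonomorphism)
open import Algebra.Lattice.Bundles using (Lattice)
open import Algebra.Lattice.Structures using (IsLattice; IsDistributiveLattice; IsSemilattice)
open import Algebra.Lattice.Structures.Biased using (isDistributiveLatticeʳʲᵐ)
open import Algebra.Lattice.Morphism.Structures using (IsLatticeMonomorphism)
import Algebra.Consequences.Setoid as Consequences
import Algebra.Definitions
import Algebra.Lattice.Morphism.LatticeMonomorphism as LatticeMonomorphism
import Algebra.Lattice.Properties.DistributiveLattice as DistributiveLatticeProperties
import Algebra.Lattice.Properties.Lattice as LatticeProperties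
import Algebra.Morphism.MonoidMonomorphism as MonoidMonomorphism
import Algebra.Properties.AbelianGroup as AbelianGroupProperties
import Algebra.Properties.CommutativeSemigroup as CommutativeSemigroupProperties
import Algebra.Properties.Monoid.Mult as MonoidMult
import Algebra.Solver.CommutativeMonoid as CommutativeMonoidSolver
import Relation.Binary.Lattice as R
import Relation.Binary.Lattice.Properties.JoinSemilattice as JoinSemilatticeProperties
import Relation.Binary.Reasoning.Setoid as ≈-Reasoning

module LatticeOrder {C : Set} {_≈_ : Rel C 0ℓ} {_∨_ _∧_ : Op₂ C}
                    (isLattice : IsLattice _≈_ _∨_ _∧_) where

  lattice : Lattice 0ℓ 0ℓ
  lattice = record { isLattice = isLattice }

  orderTheoreticLattice : R.Lattice 0ℓ 0ℓ 0ℓ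
  orderTheoreticLattice = LatticeProperties.∨-∧-orderTheoreticLattice lattice

  -- This is the library's order x ≈ x ∧ y; RawAlg and UnitalLGroup use x ∨ y ≈ y.
  open R.Lattice orderTheoreticLattice public
    using (_≤_; x≤x∨y; y≤x∨y; ∨-least; x∧y≤x; x∧y≤y; ∧-greatest; ≤-respˡ-≈; ≤-respʳ-≈)
    renaming (refl to ≤-refl; trans to ≤-trans; antisym to ≤-antisym)
  open JoinSemilatticeProperties (R.Lattice.joinSemilattice orderTheoreticLattice) public
    using (∨-monotonic; x≤y⇒x∨y≈y)

  x∨y≈y⇒x≤y : ∀ {x y} → (x ∨ y) ≈ y → x ≤ y
  x∨y≈y⇒x≤y {x} x∨y≈y = ≤-respʳ-≈ x∨y≈y (x≤x∨y x _)

  x≤y∨z⇒[x∨y]∨[x∨z]≈y∨z : ∀ {x y z} → x ≤ (y ∨ z) → ((x ∨ y) ∨ (x ∨ z)) ≈ (y ∨ z)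
  x≤y∨z⇒[x∨y]∨[x∨z]≈y∨z {x} {y} {z} x≤y∨z = ≤-antisym
    (∨-least (∨-least x≤y∨z (x≤x∨y y z)) (∨-least x≤y∨z (y≤x∨y y z)))
    (∨-monotonic (y≤x∨y x y) (y≤x∨y x z))

  y≤x⇒x∧z≤y⇒x∧z≈y∧z : ∀ {x y z} → y ≤ x → (x ∧ z) ≤ y → (x ∧ z) ≈ (y ∧ z)
  y≤x⇒x∧z≤y⇒x∧z≈y∧z {x} {y} {z} y≤x x∧z≤y = ≤-antisym
    (∧-greatest x∧z≤y (x∧y≤y x z))
    (∧-greatest (≤-trans (x∧y≤x y z) y≤x) (x∧y≤y y z))

record LatticeOrderedGroup : Set₁ where
  field
    abelianGroup : AbelianGroup 0ℓ 0ℓ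
  open AbelianGroup abelianGroup public
  infixr 6 _∨_
  infixr 7 _∧_
  field
    _∨_ _∧_               : Op₂ Carrier
    isLattice             : IsLattice _≈_ _∨_ _∧_
    translation-invariant : ∀ x y z → x ∨ y ≈ y → x ∙ z ∨ y ∙ z ≈ y ∙ z

module LatticeOrderedGroupProperties (G : LatticeOrderedGroup) where
  open LatticeOrderedGroup G
  open AbelianGroupProperties abelianGroup
    using ( //-rightDividesˡ; //-rightDividesʳ; \\-leftDividesˡ; ⁻¹-involutive; ε⁻¹≈ε; ⁻¹-∙-comm
          ; ∙-cancelˡ; ∙-cancelʳ)
  open CommutativeSemigroupProperties commutativeSemigroup using (xy∙z≈xz∙y; xy∙z≈zy∙x)
  open Consequences setoid using (comm∧distrʳ⇒distrˡ)
  open Algebra.Definitions _≈_ using (_DistributesOverˡ_; _DistributesOverʳ_)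
  open IsLattice isLattice using (∨-cong; ∧-cong)
  open LatticeOrder isLattice public
  open MonoidMult monoid public using ()
    renaming (_×_ to _·_; ×-congʳ to ·-congʳ; ×-homo-+ to ·-homo-+)
  open ≈-Reasoning setoid

  ∙-monoˡ-≤ : ∀ {x y} z → x ≤ y → x ∙ z ≤ y ∙ z
  ∙-monoˡ-≤ z x≤y = x∨y≈y⇒x≤y (translation-invariant _ _ z (x≤y⇒x∨y≈y x≤y))

  ∙-monoʳ-≤ : ∀ {x y} z → x ≤ y → z ∙ x ≤ z ∙ y
  ∙-monoʳ-≤ z x≤y = ≤-respˡ-≈ (comm _ z) (≤-respʳ-≈ (comm _ z) (∙-monoˡ-≤ z x≤y))

  ∙-mono-≤ : ∀ {x x′ y y′} → x ≤ x′ → y ≤ y′ → x ∙ y ≤ x′ ∙ y′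
  ∙-mono-≤ x≤x′ y≤y′ = ≤-trans (∙-monoˡ-≤ _ x≤x′) (∙-monoʳ-≤ _ y≤y′)

  x∙z≤y⇒x≤y∙z⁻¹ : ∀ {x y z} → x ∙ z ≤ y → x ≤ y ∙ z ⁻¹
  x∙z≤y⇒x≤y∙z⁻¹ {x} {z = z} x∙z≤y = ≤-respˡ-≈ (//-rightDividesʳ z x) (∙-monoˡ-≤ (z ⁻¹) x∙z≤y)

  x≤y∙z⁻¹⇒x∙z≤y : ∀ {x y z} → x ≤ y ∙ z ⁻¹ → x ∙ z ≤ y
  x≤y∙z⁻¹⇒x∙z≤y {y = y} {z} x≤y∙z⁻¹ = ≤-respʳ-≈ (//-rightDividesˡ z y) (∙-monoˡ-≤ z x≤y∙z⁻¹)

  y≤x∙z⇒y∙z⁻¹≤x : ∀ {x y z} → y ≤ x ∙ z → y ∙ z ⁻¹ ≤ x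
  y≤x∙z⇒y∙z⁻¹≤x {x} {z = z} y≤x∙z = ≤-respʳ-≈ (//-rightDividesʳ z x) (∙-monoˡ-≤ (z ⁻¹) y≤x∙z)

  y∙z⁻¹≤x⇒y≤x∙z : ∀ {x y z} → y ∙ z ⁻¹ ≤ x → y ≤ x ∙ z
  y∙z⁻¹≤x⇒y≤x∙z {y = y} {z} y∙z⁻¹≤x = ≤-respˡ-≈ (//-rightDividesˡ z y) (∙-monoˡ-≤ z y∙z⁻¹≤x)

  ∙-distribʳ-∨ : _∙_ DistributesOverʳ _∨_
  ∙-distribʳ-∨ z x y = ≤-antisym
    (x≤y∙z⁻¹⇒x∙z≤y (∨-least (x∙z≤y⇒x≤y∙z⁻¹ (x≤x∨y _ _)) (x∙z≤y⇒x≤y∙z⁻¹ (y≤x∨y _ _))))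
    (∨-least (∙-monoˡ-≤ z (x≤x∨y x y)) (∙-monoˡ-≤ z (y≤x∨y x y)))

  ∙-distribʳ-∧ : _∙_ DistributesOverʳ _∧_
  ∙-distribʳ-∧ z x y = ≤-antisym
    (∧-greatest (∙-monoˡ-≤ z (x∧y≤x x y)) (∙-monoˡ-≤ z (x∧y≤y x y)))
    (y∙z⁻¹≤x⇒y≤x∙z (∧-greatest (y≤x∙z⇒y∙z⁻¹≤x (x∧y≤x _ _)) (y≤x∙z⇒y∙z⁻¹≤x (x∧y≤y _ _))))

  ∙-distribˡ-∨ : _∙_ DistributesOverˡ _∨_
  ∙-distribˡ-∨ = comm∧distrʳ⇒distrˡ ∨-cong comm ∙-distribʳ-∨

  ∙-distribˡ-∧ : _∙_ DistributesOverˡ _∧_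
  ∙-distribˡ-∧ = comm∧distrʳ⇒distrˡ ∧-cong comm ∙-distribʳ-∧

  [x∨y]∙[x∧y]≈x∙y : ∀ x y → (x ∨ y) ∙ (x ∧ y) ≈ x ∙ y
  [x∨y]∙[x∧y]≈x∙y x y = ≤-antisym
    (≤-respˡ-≈ (sym (∙-distribʳ-∨ (x ∧ y) x y))
      (∨-least (∙-monoʳ-≤ x (x∧y≤y x y)) (≤-respʳ-≈ (comm y x) (∙-monoʳ-≤ y (x∧y≤x x y)))))
    (≤-respʳ-≈ (comm _ _) (y∙z⁻¹≤x⇒y≤x∙z (∧-greatest
      (y≤x∙z⇒y∙z⁻¹≤x (∙-monoʳ-≤ x (y≤x∨y x y)))
      (y≤x∙z⇒y∙z⁻¹≤x (≤-respˡ-≈ (comm y x) (∙-monoʳ-≤ y (x≤x∨y x y)))))))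

  x∧z≈y∧z⇒[x∨z]∙y≈[y∨z]∙x : ∀ {x y z} → x ∧ z ≈ y ∧ z → (x ∨ z) ∙ y ≈ (y ∨ z) ∙ x
  x∧z≈y∧z⇒[x∨z]∙y≈[y∨z]∙x {x} {y} {z} x∧z≈y∧z = ∙-cancelʳ (x ∧ z) _ _ (begin
    ((x ∨ z) ∙ y) ∙ (x ∧ z)   ≈⟨ xy∙z≈xz∙y _ _ _ ⟩
    ((x ∨ z) ∙ (x ∧ z)) ∙ y   ≈⟨ ∙-congʳ ([x∨y]∙[x∧y]≈x∙y x z) ⟩
    (x ∙ z) ∙ y               ≈⟨ xy∙z≈zy∙x x z y ⟩
    (y ∙ z) ∙ x               ≈⟨ ∙-congʳ ([x∨y]∙[x∧y]≈x∙y y z) ⟨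
    ((y ∨ z) ∙ (y ∧ z)) ∙ x   ≈⟨ xy∙z≈xz∙y _ _ _ ⟩
    ((y ∨ z) ∙ x) ∙ (y ∧ z)   ≈⟨ ∙-congˡ x∧z≈y∧z ⟨
    ((y ∨ z) ∙ x) ∙ (x ∧ z)   ∎)

  -- b ≤ a have the same meets with y and with z, so the previous lemma turns
  -- (a ∨ y) ∨ (a ∨ z) ≈ y ∨ z ≈ (b ∨ y) ∨ (b ∨ z) into (y ∨ z) ∙ a ≈ (y ∨ z) ∙ b.
  ∧-distribʳ-∨ : _∧_ DistributesOverʳ _∨_
  ∧-distribʳ-∨ x y z = ∙-cancelˡ (y ∨ z) a b (begin
    (y ∨ z) ∙ a                   ≈⟨ ∙-congʳ (x≤y∨z⇒[x∨y]∨[x∨z]≈y∨z b≤y∨z) ⟨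
    ((b ∨ y) ∨ (b ∨ z)) ∙ a       ≈⟨ ∙-distribʳ-∨ a _ _ ⟩
    (b ∨ y) ∙ a ∨ (b ∨ z) ∙ a     ≈⟨ ∨-cong (x∧z≈y∧z⇒[x∨z]∙y≈[y∨z]∙x (meets-agree (x≤x∨y _ _)))
                                           (x∧z≈y∧z⇒[x∨z]∙y≈[y∨z]∙x (meets-agree (y≤x∨y _ _))) ⟨
    (a ∨ y) ∙ b ∨ (a ∨ z) ∙ b     ≈⟨ ∙-distribʳ-∨ b _ _ ⟨
    ((a ∨ y) ∨ (a ∨ z)) ∙ b       ≈⟨ ∙-congʳ (x≤y∨z⇒[x∨y]∨[x∨z]≈y∨z (x∧y≤x (y ∨ z) x)) ⟩
    (y ∨ z) ∙ b                   ∎)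
    where
    a = (y ∨ z) ∧ x
    b = (y ∧ x) ∨ (z ∧ x)
    ∧x-below-a : ∀ {v} → v ≤ y ∨ z → v ∧ x ≤ a
    ∧x-below-a v≤y∨z = ∧-greatest (≤-trans (x∧y≤x _ x) v≤y∨z) (x∧y≤y _ x)
    b≤a : b ≤ a
    b≤a = ∨-least (∧x-below-a (x≤x∨y y z)) (∧x-below-a (y≤x∨y y z))
    b≤y∨z : b ≤ y ∨ z
    b≤y∨z = ≤-trans b≤a (x∧y≤x (y ∨ z) x)
    meets-agree : ∀ {v} → v ∧ x ≤ b → a ∧ v ≈ b ∧ v
    meets-agree {v} v∧x≤b = y≤x⇒x∧z≤y⇒x∧z≈y∧z b≤a
      (≤-trans (∧-greatest (x∧y≤y a v) (≤-trans (x∧y≤x a v) (x∧y≤y (y ∨ z) x))) v∧x≤b)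

  isDistributiveLattice : IsDistributiveLattice _≈_ _∨_ _∧_
  isDistributiveLattice = DistributiveLatticeProperties.∧-∨-isDistributiveLattice (record
    { isDistributiveLattice = isDistributiveLatticeʳʲᵐ (record
      { isLattice    = LatticeProperties.∧-∨-isLattice lattice
      ; ∨-distribʳ-∧ = ∧-distribʳ-∨
      })
    })

  ⁻¹-antimono-≤ : ∀ {x y} → x ≤ y → y ⁻¹ ≤ x ⁻¹
  ⁻¹-antimono-≤ {x} {y} x≤y = ≤-respˡ-≈ (\\-leftDividesˡ x (y ⁻¹))
    (≤-respʳ-≈ (trans (∙-congˡ (comm _ _)) (\\-leftDividesˡ y (x ⁻¹)))
      (∙-monoˡ-≤ (x ⁻¹ ∙ y ⁻¹) x≤y))

  x⁻¹≤y⇒y⁻¹≤x : ∀ {x y} → x ⁻¹ ≤ y → y ⁻¹ ≤ x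
  x⁻¹≤y⇒y⁻¹≤x {x} x⁻¹≤y = ≤-respʳ-≈ (⁻¹-involutive x) (⁻¹-antimono-≤ x⁻¹≤y)

  ·-homo-⁻¹ : ∀ n x → n · (x ⁻¹) ≈ (n · x) ⁻¹
  ·-homo-⁻¹ zero    x = sym ε⁻¹≈ε
  ·-homo-⁻¹ (suc n) x = trans (∙-congˡ (·-homo-⁻¹ n x)) (⁻¹-∙-comm x (n · x))

  ε≤x⇒ε≤n·x : ∀ {x} n → ε ≤ x → ε ≤ n · x
  ε≤x⇒ε≤n·x zero    ε≤x = ≤-refl
  ε≤x⇒ε≤n·x (suc n) ε≤x = ≤-respˡ-≈ (identityʳ ε) (∙-mono-≤ ε≤x (ε≤x⇒ε≤n·x n ε≤x))

  ·-monoˡ-≤ : ∀ {x m n} → ε ≤ x → m ℕ.≤ n → m · x ≤ n · x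
  ·-monoˡ-≤ {n = n} ε≤x z≤n   = ε≤x⇒ε≤n·x n ε≤x
  ·-monoˡ-≤ ε≤x (s≤s m≤n)     = ∙-monoʳ-≤ _ (·-monoˡ-≤ ε≤x m≤n)

  nsum≡· : ∀ n x → nsum _∙_ ε n x ≡ n · x
  nsum≡· zero    x = ≡.refl
  nsum≡· (suc n) x = ≡.cong (x ∙_) (nsum≡· n x)

module _ (A : RawAlg) (M : Monoid 0ℓ 0ℓ) where
  private
    module A = RawAlg A
  open Monoid M
  open MonoidMult M using () renaming (_×_ to _·_)

  times-homo : (h : A.Carrier → Carrier) → (∀ x y → h (x A.+ y) ≈ h x ∙ h y) → h A.0# ≈ ε →
               ∀ n x → h (A.times n x) ≈ n · h x
  times-homo h h-+ h-0 zero    x = h-0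
  times-homo h h-+ h-0 (suc n) x = trans (h-+ x _) (∙-congˡ (times-homo h h-+ h-0 n x))

module EmbeddingIntoUnitalLGroup
  (A : RawAlg) (G : UnitalLGroup) {S : Pred (UnitalLGroup.Carrier G) 0ℓ} (iso : IsIsoToSubreduct A G S)
  where
  private
    module A = RawAlg A
    module G = UnitalLGroup G
  open IsIsoToSubreduct iso using (f; f-cong; f-inj; f-+; f-∨; f-∧; f-0; f-1; f--1)

  lGroup : LatticeOrderedGroup
  lGroup = record
    { abelianGroup          = record { isAbelianGroup = G.isAbelianGroup }
    ; isLattice             = G.isLattice
    ; translation-invariant = G.translation-invariant
    }

  open LatticeOrderedGroup lGroup
    using ( _≈_; _∙_; _⁻¹; ε; rawMonoid; setoid; sym; trans; ∙-cong; ∙-congˡ; inverseˡ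
          ; monoid; isMagma; isCommutativeMonoid)
  open IsLattice G.isLattice using (∨-cong; ∧-cong)
  open LatticeOrderedGroupProperties lGroup
  open AbelianGroupProperties (LatticeOrderedGroup.abelianGroup lGroup) using (ε⁻¹≈ε; ∙-cancelʳ)
  open ≈-Reasoning setoid

  isLatticeMonomorphism : IsLatticeMonomorphism
    (record { Carrier = A.Carrier ; _≈_ = A._≈_ ; _∧_ = A._∧_ ; _∨_ = A._∨_ })
    (record { Carrier = G.Carrier ; _≈_ = G._≈_ ; _∧_ = G._∧_ ; _∨_ = G._∨_ }) f
  isLatticeMonomorphism = record
    { isLatticeHomomorphism = record
      { isRelHomomorphism = record { cong = f-cong }
      ; ∧-homo            = f-∧
      ; ∨-homo            = f-∨
      }
    ; injective = f-inj
    }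

  isMonoidMonomorphism : IsMonoidMonomorphism
    (record { Carrier = A.Carrier ; _≈_ = A._≈_ ; _∙_ = A._+_ ; ε = A.0# }) rawMonoid f
  isMonoidMonomorphism = record
    { isMonoidHomomorphism = record
      { isMagmaHomomorphism = record { isRelHomomorphism = record { cong = f-cong } ; homo = f-+ }
      ; ε-homo              = f-0
      }
    ; injective = f-inj
    }

  f-reflects-≤ : ∀ {x y} → f x ≤ f y → x A.≤ y
  f-reflects-≤ fx≤fy = f-inj (trans (f-∨ _ _) (x≤y⇒x∨y≈y fx≤fy))

  f-times : ∀ n x → f (A.times n x) ≈ n · f x
  f-times = times-homo A monoid f f-+ f-0

  +-distribˡ-transfer : ∀ {_⊕_ : Op₂ A.Carrier} {_⊞_ : Op₂ G.Carrier} →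
    (∀ x y → f (x ⊕ y) ≈ (f x ⊞ f y)) → (∀ {x y z w} → x ≈ y → z ≈ w → (x ⊞ z) ≈ (y ⊞ w)) →
    (∀ x y z → x ∙ (y ⊞ z) ≈ ((x ∙ y) ⊞ (x ∙ z))) →
    ∀ x y z → (x A.+ (y ⊕ z)) A.≈ ((x A.+ y) ⊕ (x A.+ z))
  +-distribˡ-transfer {_⊕_} {_⊞_} f-⊕ ⊞-cong ∙-distribˡ-⊞ x y z = f-inj (begin
    f (x A.+ (y ⊕ z))           ≈⟨ trans (f-+ x _) (∙-congˡ (f-⊕ y z)) ⟩
    f x ∙ (f y ⊞ f z)           ≈⟨ ∙-distribˡ-⊞ _ _ _ ⟩
    (f x ∙ f y) ⊞ (f x ∙ f z)   ≈⟨ ⊞-cong (f-+ x y) (f-+ x z) ⟨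
    f (x A.+ y) ⊞ f (x A.+ z)   ≈⟨ f-⊕ _ _ ⟨
    f ((x A.+ y) ⊕ (x A.+ z))   ∎)

  ε≤u : ε ≤ G.u
  ε≤u = x∨y≈y⇒x≤y G.u-nonneg

  u⁻¹≤ε : G.u ⁻¹ ≤ ε
  u⁻¹≤ε = ≤-respʳ-≈ ε⁻¹≈ε (⁻¹-antimono-≤ ε≤u)

  below-multiple-of-u : ∀ g → ∃ λ n → g ≤ n · G.u
  below-multiple-of-u g with G.u-strong g
  ... | n , g∨n·u≈n·u = n , ≡.subst (g ≤_) (nsum≡· n G.u) (x∨y≈y⇒x≤y g∨n·u≈n·u)

  bounded : ∀ x → ∃ λ n → (A.times (suc n) A.-1# A.≤ x) × (x A.≤ A.times (suc n) A.1#)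
  bounded x with below-multiple-of-u (f x) | below-multiple-of-u (f x ⁻¹)
  ... | n , fx≤n·u | m , fx⁻¹≤m·u = m ℕ.+ n , f-reflects-≤ lower , f-reflects-≤ upper
    where
    k = suc (m ℕ.+ n)
    upper : f x ≤ f (A.times k A.1#)
    upper = ≤-respʳ-≈ (sym (trans (f-times k A.1#) (·-congʳ k f-1)))
      (≤-trans fx≤n·u (·-monoˡ-≤ ε≤u (ℕ.m≤n+m n (suc m))))
    lower : f (A.times k A.-1#) ≤ f x
    lower = ≤-respˡ-≈ (sym (trans (f-times k A.-1#) (trans (·-congʳ k f--1) (·-homo-⁻¹ k G.u))))
      (x⁻¹≤y⇒y⁻¹≤x (≤-trans fx⁻¹≤m·u (·-monoˡ-≤ ε≤u (ℕ.m≤n⇒m≤1+n (ℕ.m≤m+n m n)))))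

  isUCDLMonoid : IsUCDLMonoid A
  isUCDLMonoid = record
    { isDistributiveLattice =
        LatticeMonomorphism.isDistributiveLattice isLatticeMonomorphism isDistributiveLattice
    ; isCommutativeMonoid   =
        MonoidMonomorphism.isCommutativeMonoid isMonoidMonomorphism isCommutativeMonoid
    ; +-distrib-∨           = +-distribˡ-transfer f-∨ ∨-cong ∙-distribˡ-∨
    ; +-distrib-∧           = +-distribˡ-transfer f-∧ ∧-cong ∙-distribˡ-∧
    ; -1+1≈0                =
        f-inj (trans (f-+ _ _) (trans (∙-cong f--1 f-1) (trans (inverseˡ G.u) (sym f-0))))
    ; -1≤0                  = f-reflects-≤ (≤-respˡ-≈ (sym f--1) (≤-respʳ-≈ (sym f-0) u⁻¹≤ε))
    ; 0≤1                   = f-reflects-≤ (≤-respˡ-≈ (sym f-0) (≤-respʳ-≈ (sym f-1) ε≤u))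
    ; bounded               = bounded
    }

  cancellative : Cancellative A
  cancellative x y z = MonoidMonomorphism.cancelʳ isMonoidMonomorphism isMagma ∙-cancelʳ z x y

module DifferenceGroup {C : Set} {_≈_ : Rel C 0ℓ} {_∙_ _∨_ _∧_ : Op₂ C} {ε : C}
  (isCommutativeMonoid : IsCommutativeMonoid _≈_ _∙_ ε)
  (isLattice : IsLattice _≈_ _∨_ _∧_)
  (∙-distribˡ-∨ : ∀ x y z → (x ∙ (y ∨ z)) ≈ ((x ∙ y) ∨ (x ∙ z)))
  (∙-distribˡ-∧ : ∀ x y z → (x ∙ (y ∧ z)) ≈ ((x ∙ y) ∧ (x ∙ z)))
  (∙-cancelʳ : ∀ x y z → (x ∙ z) ≈ (y ∙ z) → x ≈ y)
  where

  commutativeMonoid : CommutativeMonoid 0ℓ 0ℓ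
  commutativeMonoid = record { isCommutativeMonoid = isCommutativeMonoid }

  open CommutativeMonoid commutativeMonoid
    using ( setoid; refl; sym; trans; ∙-cong; ∙-congʳ; assoc; comm; identityˡ; identityʳ
          ; commutativeSemigroup)
  open CommutativeSemigroupProperties commutativeSemigroup using (interchange; xy∙z≈xz∙y; xy∙z≈x∙zy)
  open Consequences setoid using (comm∧distrˡ⇒distrʳ)
  open Algebra.Definitions _≈_ using (Congruent₂; _DistributesOverˡ_; _DistributesOverʳ_; _Absorbs_)
  open CommutativeMonoidSolver commutativeMonoid using (solve; _⊜_; _⊕_)
  open LatticeOrder isLattice using (lattice)
  module L = IsLattice isLattice
  open ≈-Reasoning setoid

  infix 6 _⊖_
  record Diff : Set where
    no-eta-equality
    pattern
    constructor _⊖_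
    field
      pos neg : C

  open Diff

  infix 4 _≋_
  record _≋_ (x y : Diff) : Set where
    constructor mk≋
    field
      cross : (pos x ∙ neg y) ≈ (pos y ∙ neg x)

  infixl 7 _∙ᴰ_
  _∙ᴰ_ : Op₂ Diff
  (a ⊖ b) ∙ᴰ (c ⊖ d) = a ∙ c ⊖ b ∙ d

  infix 8 _⁻¹ᴰ
  _⁻¹ᴰ : Op₁ Diff
  (a ⊖ b) ⁻¹ᴰ = b ⊖ a

  εᴰ : Diff
  εᴰ = ε ⊖ ε

  ι : C → Diff
  ι x = x ⊖ ε

  ≈⇒≋ : ∀ {a b c d} → a ≈ c → b ≈ d → (a ⊖ b) ≋ (c ⊖ d)
  ≈⇒≋ a≈c b≈d = mk≋ (∙-cong a≈c (sym b≈d))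

  ≋-trans : ∀ {x y z} → x ≋ y → y ≋ z → x ≋ z
  ≋-trans {a ⊖ b} {c ⊖ d} {e ⊖ f} (mk≋ ad≈cb) (mk≋ cf≈ed) = mk≋ (∙-cancelʳ (a ∙ f) (e ∙ b) d (begin
    (a ∙ f) ∙ d ≈⟨ xy∙z≈xz∙y a f d ⟩
    (a ∙ d) ∙ f ≈⟨ ∙-congʳ ad≈cb ⟩
    (c ∙ b) ∙ f ≈⟨ xy∙z≈xz∙y c b f ⟩
    (c ∙ f) ∙ b ≈⟨ ∙-congʳ cf≈ed ⟩
    (e ∙ d) ∙ b ≈⟨ xy∙z≈xz∙y e d b ⟩
    (e ∙ b) ∙ d ∎))

  ≋-isEquivalence : IsEquivalence _≋_
  ≋-isEquivalence = record
    { refl  = λ { {_ ⊖ _} → mk≋ refl }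
    ; sym   = λ { {_ ⊖ _} {_ ⊖ _} (mk≋ p) → mk≋ (sym p) }
    ; trans = ≋-trans
    }

  open IsEquivalence ≋-isEquivalence public using () renaming (refl to ≋-refl; sym to ≋-sym)

  ∙ᴰ-cong : ∀ {x y z w} → x ≋ y → z ≋ w → x ∙ᴰ z ≋ y ∙ᴰ w
  ∙ᴰ-cong {a ⊖ b} {a′ ⊖ b′} {c ⊖ d} {c′ ⊖ d′} (mk≋ ab′≈a′b) (mk≋ cd′≈c′d) = mk≋ (begin
    (a ∙ c) ∙ (b′ ∙ d′) ≈⟨ interchange a c b′ d′ ⟩
    (a ∙ b′) ∙ (c ∙ d′) ≈⟨ ∙-cong ab′≈a′b cd′≈c′d ⟩
    (a′ ∙ b) ∙ (c′ ∙ d) ≈⟨ interchange a′ b c′ d ⟩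
    (a′ ∙ c′) ∙ (b ∙ d) ∎)

  isAbelianGroup : IsAbelianGroup _≋_ _∙ᴰ_ εᴰ _⁻¹ᴰ
  isAbelianGroup = record
    { isGroup = record
      { isMonoid = record
        { isSemigroup = record
          { isMagma  = record { isEquivalence = ≋-isEquivalence ; ∙-cong = ∙ᴰ-cong }
          ; assoc    = λ { (a ⊖ b) (c ⊖ d) (e ⊖ f) → ≈⇒≋ (assoc a c e) (assoc b d f) }
          }
        ; identity = (λ { (a ⊖ b) → ≈⇒≋ (identityˡ a) (identityˡ b) })
                   , (λ { (a ⊖ b) → ≈⇒≋ (identityʳ a) (identityʳ b) })
        }
      ; inverse = (λ { (a ⊖ b) → mk≋ (trans (identityʳ _) (trans (comm b a) (sym (identityˡ _)))) })
                , (λ { (a ⊖ b) → mk≋ (trans (identityʳ _) (trans (comm a b) (sym (identityˡ _)))) })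
      ; ⁻¹-cong = λ { {a ⊖ b} {a′ ⊖ b′} (mk≋ ab′≈a′b) →
                      mk≋ (trans (comm b a′) (trans (sym ab′≈a′b) (comm a b′))) }
      }
    ; comm = λ { (a ⊖ b) (c ⊖ d) → ≈⇒≋ (comm a c) (comm b d) }
    }

  abelianGroup : AbelianGroup 0ℓ 0ℓ
  abelianGroup = record { isAbelianGroup = isAbelianGroup }

  lift : Op₂ C → Op₂ Diff
  lift _⊔_ (a ⊖ b) (c ⊖ d) = (a ∙ d) ⊔ (c ∙ b) ⊖ b ∙ d

  module Lift {_⊔_ : Op₂ C} (isSemilattice : IsSemilattice _≈_ _⊔_)
              (∙-distribˡ-⊔ : _∙_ DistributesOverˡ _⊔_) where
    open IsSemilattice _≈_ isSemilattice using ()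
      renaming (comm to ⊔-comm; assoc to ⊔-assoc; ∙-cong to ⊔-cong)

    ∙-distribʳ-⊔ : _∙_ DistributesOverʳ _⊔_
    ∙-distribʳ-⊔ = comm∧distrˡ⇒distrʳ ⊔-cong comm ∙-distribˡ-⊔

    lift-comm : ∀ x y → lift _⊔_ x y ≋ lift _⊔_ y x
    lift-comm (a ⊖ b) (c ⊖ d) = ≈⇒≋ (⊔-comm _ _) (comm b d)

    lift-assoc : ∀ x y z → lift _⊔_ (lift _⊔_ x y) z ≋ lift _⊔_ x (lift _⊔_ y z)
    lift-assoc (a ⊖ b) (c ⊖ d) (e ⊖ f) = ≈⇒≋ (begin
      (((a ∙ d) ⊔ (c ∙ b)) ∙ f) ⊔ (e ∙ (b ∙ d))         ≈⟨ ⊔-cong (∙-distribʳ-⊔ f _ _) refl ⟩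
      (((a ∙ d) ∙ f) ⊔ ((c ∙ b) ∙ f)) ⊔ (e ∙ (b ∙ d))   ≈⟨ ⊔-assoc _ _ _ ⟩
      ((a ∙ d) ∙ f) ⊔ (((c ∙ b) ∙ f) ⊔ (e ∙ (b ∙ d)))
        ≈⟨ ⊔-cong (assoc a d f) (⊔-cong (xy∙z≈xz∙y c b f)
             (solve 3 (λ e b d → (e ⊕ (b ⊕ d)) ⊜ ((e ⊕ d) ⊕ b)) refl e b d)) ⟩
      (a ∙ (d ∙ f)) ⊔ (((c ∙ f) ∙ b) ⊔ ((e ∙ d) ∙ b))   ≈⟨ ⊔-cong refl (∙-distribʳ-⊔ b _ _) ⟨
      (a ∙ (d ∙ f)) ⊔ (((c ∙ f) ⊔ (e ∙ d)) ∙ b)         ∎) (assoc b d f)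

    lift-cong : ∀ {x y z w} → x ≋ y → z ≋ w → lift _⊔_ x z ≋ lift _⊔_ y w
    lift-cong {a ⊖ b} {a′ ⊖ b′} {c ⊖ d} {c′ ⊖ d′} (mk≋ ab′≈a′b) (mk≋ cd′≈c′d) = mk≋ (begin
      ((a ∙ d) ⊔ (c ∙ b)) ∙ (b′ ∙ d′)                 ≈⟨ ∙-distribʳ-⊔ _ _ _ ⟩
      ((a ∙ d) ∙ (b′ ∙ d′)) ⊔ ((c ∙ b) ∙ (b′ ∙ d′))   ≈⟨ ⊔-cong left right ⟩
      ((a′ ∙ d′) ∙ (b ∙ d)) ⊔ ((c′ ∙ b′) ∙ (b ∙ d))   ≈⟨ ∙-distribʳ-⊔ _ _ _ ⟨
      ((a′ ∙ d′) ⊔ (c′ ∙ b′)) ∙ (b ∙ d)               ∎)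
      where
      left : ((a ∙ d) ∙ (b′ ∙ d′)) ≈ ((a′ ∙ d′) ∙ (b ∙ d))
      left = trans (interchange a d b′ d′) (trans (∙-congʳ ab′≈a′b)
        (solve 4 (λ a′ b d d′ → ((a′ ⊕ b) ⊕ (d ⊕ d′)) ⊜ ((a′ ⊕ d′) ⊕ (b ⊕ d))) refl a′ b d d′))
      right : ((c ∙ b) ∙ (b′ ∙ d′)) ≈ ((c′ ∙ b′) ∙ (b ∙ d))
      right = trans
        (solve 4 (λ c b b′ d′ → ((c ⊕ b) ⊕ (b′ ⊕ d′)) ⊜ ((c ⊕ d′) ⊕ (b ⊕ b′))) refl c b b′ d′)
        (trans (∙-congʳ cd′≈c′d)
          (solve 4 (λ c′ d b b′ → ((c′ ⊕ d) ⊕ (b ⊕ b′)) ⊜ ((c′ ⊕ b′) ⊕ (b ⊕ d))) refl c′ d b b′))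

    ∙ᴰ-distribʳ-lift : ∀ z x y → lift _⊔_ x y ∙ᴰ z ≋ lift _⊔_ (x ∙ᴰ z) (y ∙ᴰ z)
    ∙ᴰ-distribʳ-lift (e ⊖ f) (a ⊖ b) (c ⊖ d) = mk≋ (begin
      (((a ∙ d) ⊔ (c ∙ b)) ∙ e) ∙ ((b ∙ f) ∙ (d ∙ f))       ≈⟨ ∙-congʳ (∙-distribʳ-⊔ e _ _) ⟩
      (((a ∙ d) ∙ e) ⊔ ((c ∙ b) ∙ e)) ∙ ((b ∙ f) ∙ (d ∙ f)) ≈⟨ ∙-distribʳ-⊔ _ _ _ ⟩
      (((a ∙ d) ∙ e) ∙ ((b ∙ f) ∙ (d ∙ f))) ⊔ (((c ∙ b) ∙ e) ∙ ((b ∙ f) ∙ (d ∙ f)))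
        ≈⟨ ⊔-cong (solve 6 (λ a b c d e f → (((a ⊕ d) ⊕ e) ⊕ ((b ⊕ f) ⊕ (d ⊕ f)))
                                          ⊜ (((a ⊕ e) ⊕ (d ⊕ f)) ⊕ ((b ⊕ d) ⊕ f))) refl a b c d e f)
                  (solve 6 (λ a b c d e f → (((c ⊕ b) ⊕ e) ⊕ ((b ⊕ f) ⊕ (d ⊕ f)))
                                          ⊜ (((c ⊕ e) ⊕ (b ⊕ f)) ⊕ ((b ⊕ d) ⊕ f))) refl a b c d e f) ⟩
      (((a ∙ e) ∙ (d ∙ f)) ∙ ((b ∙ d) ∙ f)) ⊔ (((c ∙ e) ∙ (b ∙ f)) ∙ ((b ∙ d) ∙ f))
        ≈⟨ ∙-distribʳ-⊔ _ _ _ ⟨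
      (((a ∙ e) ∙ (d ∙ f)) ⊔ ((c ∙ e) ∙ (b ∙ f))) ∙ ((b ∙ d) ∙ f) ∎)

  lift-absorbs : ∀ {_⊔_ _⊓_ : Op₂ C} → Congruent₂ _⊔_ → Congruent₂ _⊓_ →
                 _∙_ DistributesOverʳ _⊓_ → _⊔_ Absorbs _⊓_ →
                 ∀ x y → lift _⊔_ x (lift _⊓_ x y) ≋ x
  lift-absorbs {_⊔_} {_⊓_} ⊔-cong ⊓-cong ∙-distribʳ-⊓ ⊔-absorbs-⊓ (a ⊖ b) (c ⊖ d) = mk≋ (begin
    ((a ∙ (b ∙ d)) ⊔ (((a ∙ d) ⊓ (c ∙ b)) ∙ b)) ∙ b
      ≈⟨ ∙-congʳ (⊔-cong refl (trans (∙-distribʳ-⊓ b _ _) (⊓-cong (xy∙z≈x∙zy a d b) refl))) ⟩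
    ((a ∙ (b ∙ d)) ⊔ ((a ∙ (b ∙ d)) ⊓ ((c ∙ b) ∙ b))) ∙ b
      ≈⟨ ∙-congʳ (⊔-absorbs-⊓ _ _) ⟩
    (a ∙ (b ∙ d)) ∙ b
      ≈⟨ xy∙z≈x∙zy a (b ∙ d) b ⟩
    a ∙ (b ∙ (b ∙ d)) ∎)

  infixr 6 _∨ᴰ_
  _∨ᴰ_ : Op₂ Diff
  _∨ᴰ_ = lift _∨_

  infixr 7 _∧ᴰ_
  _∧ᴰ_ : Op₂ Diff
  _∧ᴰ_ = lift _∧_

  private
    module ∨ᴰ = Lift (LatticeProperties.∨-isSemilattice lattice) ∙-distribˡ-∨
    module ∧ᴰ = Lift (LatticeProperties.∧-isSemilattice lattice) ∙-distribˡ-∧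

  isLatticeᴰ : IsLattice _≋_ _∨ᴰ_ _∧ᴰ_
  isLatticeᴰ = record
    { isEquivalence = ≋-isEquivalence
    ; ∨-comm        = ∨ᴰ.lift-comm
    ; ∨-assoc       = ∨ᴰ.lift-assoc
    ; ∨-cong        = ∨ᴰ.lift-cong
    ; ∧-comm        = ∧ᴰ.lift-comm
    ; ∧-assoc       = ∧ᴰ.lift-assoc
    ; ∧-cong        = ∧ᴰ.lift-cong
    ; absorptive    = lift-absorbs L.∨-cong L.∧-cong ∧ᴰ.∙-distribʳ-⊔ L.∨-absorbs-∧
                    , lift-absorbs L.∧-cong L.∨-cong ∨ᴰ.∙-distribʳ-⊔ L.∧-absorbs-∨
    }

  translation-invariant : ∀ x y z → x ∨ᴰ y ≋ y → x ∙ᴰ z ∨ᴰ y ∙ᴰ z ≋ y ∙ᴰ z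
  translation-invariant x y z x∨y≋y =
    ≋-trans (≋-sym (∨ᴰ.∙ᴰ-distribʳ-lift z x y)) (∙ᴰ-cong x∨y≋y ≋-refl)

  lGroup : LatticeOrderedGroup
  lGroup = record
    { abelianGroup          = abelianGroup
    ; isLattice             = isLatticeᴰ
    ; translation-invariant = translation-invariant
    }

  ι-∙ : ∀ x y → ι (x ∙ y) ≋ ι x ∙ᴰ ι y
  ι-∙ x y = ≈⇒≋ refl (sym (identityˡ ε))

  ι-∨ : ∀ x y → ι (x ∨ y) ≋ ι x ∨ᴰ ι y
  ι-∨ x y = ≈⇒≋ (L.∨-cong (sym (identityʳ x)) (sym (identityʳ y))) (sym (identityˡ ε))

  ι-∧ : ∀ x y → ι (x ∧ y) ≋ ι x ∧ᴰ ι y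
  ι-∧ x y = ≈⇒≋ (L.∧-cong (sym (identityʳ x)) (sym (identityʳ y))) (sym (identityˡ ε))

  ι-injective : ∀ {x y} → ι x ≋ ι y → x ≈ y
  ι-injective (mk≋ xε≈yε) = ∙-cancelʳ _ _ ε xε≈yε

module DifferenceUnitalLGroup
  (A : RawAlg) (U : IsUCDLMonoid A) (cancellative : Cancellative A) where
  private
    module A = RawAlg A
  open IsUCDLMonoid U
  open IsDistributiveLattice isDistributiveLattice using (isLattice)
  open IsCommutativeMonoid isCommutativeMonoid using (refl; sym; trans; identityˡ; identityʳ)
  open DifferenceGroup isCommutativeMonoid isLattice +-distrib-∨ +-distrib-∧ cancellative
  open LatticeOrderedGroup lGroup using (monoid)
  open LatticeOrderedGroupProperties lGroup

  u : Diff
  u = ι A.1#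

  ι-times : ∀ n x → ι (A.times n x) ≋ n · ι x
  ι-times = times-homo A monoid ι ι-∙ ≋-refl

  ι-mono : ∀ {x y} → x A.≤ y → ι x ≤ ι y
  ι-mono {x} {y} x∨y≈y = x∨y≈y⇒x≤y (≋-trans (≋-sym (ι-∨ x y)) (≈⇒≋ x∨y≈y refl))

  ι-⁻¹ : ι A.-1# ≋ u ⁻¹ᴰ
  ι-⁻¹ = mk≋ (trans -1+1≈0 (sym (identityˡ A.0#)))

  below-multiple-of-u : ∀ g → ∃ λ n → g ≤ n · u
  below-multiple-of-u (a ⊖ b) with bounded a | bounded b
  ... | n , _ , a≤n·1 | m , m·-1≤b , _ = suc n ℕ.+ suc m ,
    ≤-respʳ-≈ (≋-sym (·-homo-+ u (suc n) (suc m)))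
      (≤-respˡ-≈ (≈⇒≋ (identityʳ a) (identityˡ b)) (∙-mono-≤ ιa≤ ιb⁻¹≤))
    where
    ιa≤ : ι a ≤ suc n · u
    ιa≤ = ≤-respʳ-≈ (ι-times (suc n) A.1#) (ι-mono a≤n·1)
    ιb⁻¹≤ : ι b ⁻¹ᴰ ≤ suc m · u
    ιb⁻¹≤ = x⁻¹≤y⇒y⁻¹≤x (≤-respˡ-≈
      (≋-trans (ι-times (suc m) A.-1#) (≋-trans (·-congʳ (suc m) ι-⁻¹) (·-homo-⁻¹ (suc m) u)))
      (ι-mono m·-1≤b))

  unitalLGroup : UnitalLGroup
  unitalLGroup = record
    { Carrier               = Diff
    ; _≈_                   = _≋_
    ; _+_                   = _∙ᴰ_
    ; _∨_                   = _∨ᴰ_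
    ; _∧_                   = _∧ᴰ_
    ; -_                    = _⁻¹ᴰ
    ; 0#                    = εᴰ
    ; u                     = u
    ; isAbelianGroup        = isAbelianGroup
    ; isLattice             = isLatticeᴰ
    ; translation-invariant = translation-invariant
    ; u-nonneg              = x≤y⇒x∨y≈y (ι-mono 0≤1)
    ; u-strong              = u-strong
    }
    where
    u-strong : ∀ g → ∃ λ n → (g ∨ᴰ nsum _∙ᴰ_ εᴰ n u) ≋ nsum _∙ᴰ_ εᴰ n u
    u-strong g with below-multiple-of-u g
    ... | n , g≤n·u = n , x≤y⇒x∨y≈y (≡.subst (g ≤_) (≡.sym (nsum≡· n u)) g≤n·u)

  Image : Pred Diff 0ℓ
  Image g = ∃ λ x → ι x ≋ g

  Image-closed : ∀ {_⊕_ : Op₂ A.Carrier} {_⊞_ : Op₂ Diff} →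
    (∀ x y → ι (x ⊕ y) ≋ (ι x ⊞ ι y)) → (∀ {x y z w} → x ≋ y → z ≋ w → (x ⊞ z) ≋ (y ⊞ w)) →
    ∀ {g h} → g ∈ Image → h ∈ Image → (g ⊞ h) ∈ Image
  Image-closed {_⊕_} ι-⊕ ⊞-cong (x , ιx≋g) (y , ιy≋h) = x ⊕ y , ≋-trans (ι-⊕ x y) (⊞-cong ιx≋g ιy≋h)

  isSubreduct : IsSubreduct unitalLGroup Image
  isSubreduct = record
    { respects-≈ = λ { g≋h (x , ιx≋g) → x , ≋-trans ιx≋g g≋h }
    ; +-closed   = Image-closed ι-∙ ∙ᴰ-cong
    ; ∨-closed   = Image-closed ι-∨ (IsLattice.∨-cong isLatticeᴰ)
    ; ∧-closed   = Image-closed ι-∧ (IsLattice.∧-cong isLatticeᴰ)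
    ; 0-closed   = A.0# , ≋-refl
    ; u-closed   = A.1# , ≋-refl
    ; -u-closed  = A.-1# , ι-⁻¹
    }

  isIsoToSubreduct : IsIsoToSubreduct A unitalLGroup Image
  isIsoToSubreduct = record
    { f      = ι
    ; f-into = λ x → x , ≋-refl
    ; f-cong = λ x≈y → ≈⇒≋ x≈y refl
    ; f-inj  = ι-injective
    ; f-onto = λ g∈Image → g∈Image
    ; f-+    = ι-∙
    ; f-∨    = ι-∨
    ; f-∧    = ι-∧
    ; f-0    = ≋-refl
    ; f-1    = ≋-refl
    ; f--1   = ι-⁻¹
    }

  isoToSubreduct : IsoToSubreductOfUnitalLGroup A
  isoToSubreduct = unitalLGroup , Image , isSubreduct , isIsoToSubreduct

proposition4p1 : (A : RawAlg) →
    IsoToSubreductOfUnitalLGroup A ⇔ (IsUCDLMonoid A × Cancellative A)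
proposition4p1 A = mk⇔
  (λ { (G , _ , _ , iso) → EmbeddingIntoUnitalLGroup.isUCDLMonoid A G iso
                         , EmbeddingIntoUnitalLGroup.cancellative A G iso })
  (λ { (U , cancellative) → DifferenceUnitalLGroup.isoToSubreduct A U cancellative })
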